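{- Let $n\ge1$ and let $[a_1,\ldots,a_n]$ be the passive form of an up-down permutation of $\{1,\ldots,n\}$. Then there is a finite sequence of moves, each of which interchanges the entries in two positions $i,j$ (i.e. left multiplication by the transposition $(i,j)$), transforming it into the canonical up-down permutation $[1,n,2,n-1,3,\ldots]$, such that every intermediate permutation is up-down and each move is acceptable for the permutation to which it is applied.
   Context: The passive form of a permutation is the sequence $[a_1,\ldots,a_n]$ of its values. A permutation is up-down if $a_1<a_2>a_3<a_4>\cdots$. The canonical up-down permutation has passive form $[1,n,2,n-1,3,n-2,\ldots]$. A transposition $(i,j)$ of positions is acceptable for $[a_1,\ldots,a_n]$ if $|i-j|>1$ and $|a_i-a_j|=1$. -}

module Defs where

open import Data.Nat using (ℕ; zero; suc; _+_; _∸_; _<_; _>_; _≤_)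
open import Data.Nat.Properties using ()
open import Data.Nat.DivMod using (_/_; _%_)
open import Data.Fin using (Fin; toℕ; _≟_)
open import Data.Product using (_×_; Σ; _,_)
open import Relation.Nullary using (¬_; yes; no)
open import Relation.Binary.PropositionalEquality using (_≡_)
open import Function.Definitions using (Injective)

-- Passive form [a_1,...,a_n] of a sequence: positions are Fin n
-- (position p : Fin n stands for the 1-indexed position toℕ p + 1),
-- values are natural numbers (the value a_i itself, in {1,...,n}).
PassiveForm : ℕ → Set
PassiveForm n = Fin n → ℕ

IsPermutation : ∀ {n} → PassiveForm n → Set
IsPermutation {n} a = ((i : Fin n) → (1 ≤ a i) × (a i ≤ n)) × Injective _≡_ _≡_ a

data Parity : Set where
  even odd : Parity

parity : ℕ → Parity
parity zero = even
parity (suc zero) = odd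
parity (suc (suc m)) = parity m

-- Up-down: a_1 < a_2 > a_3 < a_4 > ...
-- For consecutive positions i, i+1 (0-indexed i = toℕ p, toℕ q = toℕ p + 1):
-- if i is even (1-indexed odd) then a_i < a_{i+1}, else a_i > a_{i+1}.
IsUpDown : ∀ {n} → PassiveForm n → Set
IsUpDown {n} a = (p q : Fin n) → toℕ q ≡ suc (toℕ p) → Step (parity (toℕ p)) (a p) (a q)
  where
  Step : Parity → ℕ → ℕ → Set
  Step even x y = x < y
  Step odd  x y = x > y

canonical : (n : ℕ) → PassiveForm n
canonical n p with parity (toℕ p)
... | even = toℕ p / 2 + 1
... | odd  = n ∸ (toℕ p / 2)

swapAt : ∀ {n} → Fin n → Fin n → PassiveForm n → PassiveForm n
swapAt i j a k with k ≟ i | k ≟ j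
... | yes _ | _     = a j
... | no _  | yes _ = a i
... | no _  | no _  = a k

∣_-_∣ : ℕ → ℕ → ℕ
∣ x - y ∣ = (x ∸ y) + (y ∸ x)

Acceptable : ∀ {n} → PassiveForm n → Fin n → Fin n → Set
Acceptable a i j = (∣ toℕ i - toℕ j ∣ > 1) × (∣ a i - a j ∣ ≡ 1)

-- The endpoint is
-- reached when the passive forms agree pointwise (avoids function extensionality).
data UpDownPath {n} : PassiveForm n → PassiveForm n → Set where
  done : ∀ {a b} → ((k : Fin n) → a k ≡ b k) → UpDownPath a b
  move : ∀ {a b} (i j : Fin n) →
         Acceptable a i j →
         IsUpDown (swapAt i j a) →
         UpDownPath (swapAt i j a) b →
         UpDownPath a b

{-# OPTIONS --safe #-}
-- Fix the entries from left to right. Once the first p entries agree with the canonical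
-- permutation, the remaining entries are exactly the values of a window (lo, hi], and
-- position p (counted from 0) must receive lo + 1 if p is even (a valley) and hi if p
-- is odd (a peak).
-- If a valley holds v > lo + 1, then v − 1 lies in the window, hence to the right of p,
-- and not at p + 1 because the permutation rises there; so interchanging v and v − 1 is
-- acceptable. Interchanging consecutive values at non-adjacent positions changes no
-- comparison between neighbouring entries, so the permutation stays up-down. Repeating
-- lowers the valley to lo + 1; a peak holding v < hi is raised symmetrically using v + 1.
module Submission where

open import Defs
open import Data.Nat using (ℕ; zero; suc; pred; _+_; _∸_; _<_; _≤_; z≤n; s≤s; s≤s⁻¹)
open import Data.Nat.Properties
  using ( ≤-refl; ≤-reflexive; ≤-trans; <-trans; ≤-<-trans; <-≤-trans; <-irrefl; <-asym; <⇒≤; <⇒≢; <⇒≱; ≰⇒>; ≮⇒≥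
        ; ≤∧≢⇒<; n<1+n; n≤1+n; 1+n≰n; m≤n⇒m≤1+n; m<n⇒m<1+n; m<1+n⇒m<n∨m≡n; m≤n⇒m<n∨m≡n; m≤m+n; m≤n+m
        ; +-comm; +-suc; +-identityʳ; +-∸-assoc; m+n∸n≡m; m∸n+n≡m; m∸n≤m; m≤n⇒m∸n≡0; ∸-monoˡ-≤ )
open import Data.Nat.DivMod using (_/_; m/n≡1+[m∸n]/n)
open import Data.Fin using (Fin; toℕ; fromℕ<; _≟_; punchOut)
open import Data.Fin.Properties using (toℕ-injective; toℕ<n; toℕ-fromℕ<; punchOut-injective; any?; injective⇒≤)
open import Data.Fin.Permutation.Components using (transpose; transpose-inverse)
open import Data.Product using (_×_; _,_; proj₁; proj₂; ∃)
open import Data.Sum using (_⊎_; inj₁; inj₂; [_,_]′; map₁; map₂)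
open import Function using (_∘_)
open import Function.Definitions using (Injective)
open import Relation.Nullary using (¬_; yes; no; contradiction)
open import Relation.Binary.PropositionalEquality

n≡1+m⇒∣m-n∣≡1 : ∀ {m n} → n ≡ suc m → ∣ m - n ∣ ≡ 1
n≡1+m⇒∣m-n∣≡1 {m} refl = cong₂ _+_ (m≤n⇒m∸n≡0 (n≤1+n m)) (m+n∸n≡m 1 m)

∣-∣-comm : ∀ m n → ∣ m - n ∣ ≡ ∣ n - m ∣
∣-∣-comm m n = +-comm (m ∸ n) (n ∸ m)

2+m≤n⇒1<∣n-m∣ : ∀ {m n} → 2 + m ≤ n → 1 < ∣ n - m ∣
2+m≤n⇒1<∣n-m∣ {m} {n} le =
  ≤-trans (subst (_≤ n ∸ m) (m+n∸n≡m 2 m) (∸-monoˡ-≤ m le)) (m≤m+n (n ∸ m) (m ∸ n))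

m∸n≡1+[m∸1+n] : ∀ {m n} → n < m → m ∸ n ≡ suc (m ∸ suc n)
m∸n≡1+[m∸1+n] {suc m} (s≤s n≤m) = +-∸-assoc 1 n≤m

halve : ∀ m → ∃ λ k → m ≡ k + k ⊎ m ≡ suc (k + k)
halve zero = 0 , inj₁ refl
halve (suc m) with halve m
... | k , inj₁ refl = k , inj₂ refl
... | k , inj₂ refl = suc k , inj₁ (cong suc (sym (+-suc k k)))

parity[n+n]≡even : ∀ n → parity (n + n) ≡ even
parity[n+n]≡even zero = refl
parity[n+n]≡even (suc n) rewrite +-suc n n = parity[n+n]≡even n

parity[1+n+n]≡odd : ∀ n → parity (suc (n + n)) ≡ odd
parity[1+n+n]≡odd zero = refl
parity[1+n+n]≡odd (suc n) rewrite +-suc n n = parity[1+n+n]≡odd n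

[n+n]/2≡n : ∀ n → (n + n) / 2 ≡ n
[n+n]/2≡n zero = refl
[n+n]/2≡n (suc n) rewrite +-suc n n =
  trans (m/n≡1+[m∸n]/n {2 + (n + n)} (s≤s (s≤s z≤n))) (cong suc ([n+n]/2≡n n))

[1+n+n]/2≡n : ∀ n → suc (n + n) / 2 ≡ n
[1+n+n]/2≡n zero = refl
[1+n+n]/2≡n (suc n) rewrite +-suc n n =
  trans (m/n≡1+[m∸n]/n {3 + (n + n)} (s≤s (s≤s z≤n))) (cong suc ([1+n+n]/2≡n n))

canonical-even : ∀ {n k} {q : Fin n} → toℕ q ≡ k + k → canonical n q ≡ suc k
canonical-even {k = k} {q} q≡2k with parity (toℕ q) | trans (cong parity q≡2k) (parity[n+n]≡even k)
... | even | _ = trans (cong (λ m → m / 2 + 1) q≡2k) (trans (cong (_+ 1) ([n+n]/2≡n k)) (+-comm k 1))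
... | odd  | ()

canonical-odd : ∀ {n k} {q : Fin n} → toℕ q ≡ suc (k + k) → canonical n q ≡ n ∸ k
canonical-odd {n} {k} {q} q≡2k+1 with parity (toℕ q) | trans (cong parity q≡2k+1) (parity[1+n+n]≡odd k)
... | odd  | _ = trans (cong (λ m → n ∸ m / 2) q≡2k+1) (cong (n ∸_) ([1+n+n]/2≡n k))
... | even | ()

module _ {n} {a : PassiveForm n} (ud : IsUpDown a) {p q : Fin n} (adj : toℕ q ≡ suc (toℕ p)) where

  IsUpDown⇒ascent : parity (toℕ p) ≡ even → a p < a q
  IsUpDown⇒ascent even-p with parity (toℕ p) | ud p q adj
  IsUpDown⇒ascent refl | even | a[p]<a[q] = a[p]<a[q]

  IsUpDown⇒descent : parity (toℕ p) ≡ odd → a q < a p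
  IsUpDown⇒descent odd-p with parity (toℕ p) | ud p q adj
  IsUpDown⇒descent refl | odd | a[q]<a[p] = a[q]<a[p]

injective⇒surjective : ∀ {n} {f : Fin n → Fin n} → Injective _≡_ _≡_ f → ∀ y → ∃ λ x → f x ≡ y
injective⇒surjective {suc n} {f} f-injective y with any? (λ x → f x ≟ y)
... | yes hit = hit
... | no miss = contradiction (injective⇒≤ g-injective) 1+n≰n
  where
  y≢f : ∀ x → y ≢ f x
  y≢f x y≡fx = miss (x , sym y≡fx)
  g : Fin (suc n) → Fin n
  g x = punchOut (y≢f x)
  g-injective : Injective _≡_ _≡_ g
  g-injective gx≡gy = f-injective (punchOut-injective (y≢f _) (y≢f _) gx≡gy)

IsPermutation⇒surjective : ∀ {n} {a : PassiveForm n} → IsPermutation a →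
                           ∀ {v} → 1 ≤ v → v ≤ n → ∃ λ r → a r ≡ v
IsPermutation⇒surjective {n} {a} (bounds , a-injective) {suc v} _ v<n =
  r , trans (sym (suc-toℕ-index r)) (cong suc (trans (cong toℕ index[r]≡v) (toℕ-fromℕ< v<n)))
  where
  pred<n : ∀ {x} → 1 ≤ x × x ≤ n → pred x < n
  pred<n (s≤s _ , x≤n) = x≤n
  suc∘pred : ∀ {x} → 1 ≤ x → suc (pred x) ≡ x
  suc∘pred (s≤s _) = refl
  index : Fin n → Fin n
  index r = fromℕ< (pred<n (bounds r))
  suc-toℕ-index : ∀ r → suc (toℕ (index r)) ≡ a r
  suc-toℕ-index r = trans (cong suc (toℕ-fromℕ< _)) (suc∘pred (proj₁ (bounds r)))
  index-injective : Injective _≡_ _≡_ index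
  index-injective {x} {y} e =
    a-injective (trans (sym (suc-toℕ-index x)) (trans (cong (suc ∘ toℕ) e) (suc-toℕ-index y)))
  r : Fin n
  r = proj₁ (injective⇒surjective index-injective (fromℕ< v<n))
  index[r]≡v : index r ≡ fromℕ< v<n
  index[r]≡v = proj₂ (injective⇒surjective index-injective (fromℕ< v<n))

module _ {n} (i j : Fin n) (a : PassiveForm n) where

  swapAt-i : swapAt i j a i ≡ a j
  swapAt-i with i ≟ i
  ... | yes _ = refl
  ... | no i≢i = contradiction refl i≢i

  swapAt-j : swapAt i j a j ≡ a i
  swapAt-j with j ≟ i | j ≟ j
  ... | yes refl | _     = refl
  ... | no _     | yes _ = refl
  ... | no _     | no j≢j = contradiction refl j≢j

  swapAt-other : ∀ {k} → k ≢ i → k ≢ j → swapAt i j a k ≡ a k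
  swapAt-other {k} k≢i k≢j with k ≟ i | k ≟ j
  ... | yes k≡i | _       = contradiction k≡i k≢i
  ... | no _    | yes k≡j = contradiction k≡j k≢j
  ... | no _    | no _    = refl

  swapAt≡∘transpose : ∀ k → swapAt i j a k ≡ a (transpose i j k)
  swapAt≡∘transpose k with k ≟ i
  ... | yes _ = refl
  ... | no _ with k ≟ j
  ...   | yes _ = refl
  ...   | no _  = refl

  swapAt-IsPermutation : IsPermutation a → IsPermutation (swapAt i j a)
  swapAt-IsPermutation (bounds , a-injective) =
    (λ k → subst (λ v → 1 ≤ v × v ≤ n) (sym (swapAt≡∘transpose k)) (bounds _)) , swapped-injective
    where
    transpose-injective : Injective _≡_ _≡_ (transpose i j)
    transpose-injective e =
      trans (sym (transpose-inverse j i)) (trans (cong (transpose j i) e) (transpose-inverse j i))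
    swapped-injective : Injective _≡_ _≡_ (swapAt i j a)
    swapped-injective {x} {y} e = transpose-injective
      (a-injective (trans (sym (swapAt≡∘transpose x)) (trans e (swapAt≡∘transpose y))))

module _ {n} {a : PassiveForm n} (a-injective : Injective _≡_ _≡_ a) {i j : Fin n}
         (a[j]≡1+a[i] : a j ≡ suc (a i)) (far : 1 < ∣ toℕ i - toℕ j ∣) where

  private
    a[i]<a[j] : a i < a j
    a[i]<a[j] = ≤-reflexive (sym a[j]≡1+a[i])

  swapAt-preserves-< : ∀ {x y} → ∣ toℕ x - toℕ y ∣ ≡ 1 → a x < a y → swapAt i j a x < swapAt i j a y
  swapAt-preserves-< {x} {y} near a[x]<a[y] with x ≟ i | x ≟ j | y ≟ i | y ≟ j
  ... | yes refl | _        | yes refl | _        = contradiction a[x]<a[y] (<-irrefl refl)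
  ... | yes refl | _        | no _     | yes refl = contradiction far (<-irrefl (sym near))
  ... | yes refl | _        | no _     | no y≢j   =
    ≤∧≢⇒< (subst (_≤ a y) (sym a[j]≡1+a[i]) a[x]<a[y]) (λ a[j]≡a[y] → y≢j (sym (a-injective a[j]≡a[y])))
  ... | no _     | yes refl | yes refl | _        =
    contradiction far (<-irrefl (sym (trans (∣-∣-comm (toℕ i) (toℕ j)) near)))
  ... | no _     | yes refl | no _     | yes refl = contradiction a[x]<a[y] (<-irrefl refl)
  ... | no _     | yes refl | no _     | no _     = <-trans a[i]<a[j] a[x]<a[y]
  ... | no _     | no _     | yes refl | _        = <-trans a[x]<a[y] a[i]<a[j]
  ... | no x≢i   | no _     | no _     | yes refl =
    ≤∧≢⇒< (s≤s⁻¹ (subst (a x <_) a[j]≡1+a[i] a[x]<a[y])) (x≢i ∘ a-injective)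
  ... | no _     | no _     | no _     | no _     = a[x]<a[y]

  swapAt-IsUpDown : IsUpDown a → IsUpDown (swapAt i j a)
  swapAt-IsUpDown ud p q adj with parity (toℕ p) | ud p q adj
  ... | even | a[p]<a[q] = swapAt-preserves-< (n≡1+m⇒∣m-n∣≡1 adj) a[p]<a[q]
  ... | odd  | a[q]<a[p] = swapAt-preserves-< (trans (∣-∣-comm (toℕ q) (toℕ p)) (n≡1+m⇒∣m-n∣≡1 adj)) a[q]<a[p]

moveAdjacentValues : ∀ {n} {a b : PassiveForm n} {i j} → IsPermutation a → IsUpDown a →
                     a j ≡ suc (a i) → 1 < ∣ toℕ i - toℕ j ∣ →
                     (IsPermutation (swapAt i j a) → IsUpDown (swapAt i j a) → UpDownPath (swapAt i j a) b) →
                     UpDownPath a b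
moveAdjacentValues {i = i} {j} perm ud a[j]≡1+a[i] far continue =
  move i j (far , n≡1+m⇒∣m-n∣≡1 a[j]≡1+a[i]) ud′ (continue (swapAt-IsPermutation i j _ perm) ud′)
  where
  ud′ = swapAt-IsUpDown (proj₂ perm) a[j]≡1+a[i] far ud

module Completion (n : ℕ) where

  c : PassiveForm n
  c = canonical n

  CanonicalBelow : ℕ → PassiveForm n → Set
  CanonicalBelow p a = ∀ q → toℕ q < p → a q ≡ c q

  CanonicalBelow-swapAt : ∀ {p a i j} → p ≤ toℕ i → p ≤ toℕ j →
                          CanonicalBelow p a → CanonicalBelow p (swapAt i j a)
  CanonicalBelow-swapAt {a = a} {i} {j} p≤i p≤j fixed q q<p =
    trans (swapAt-other i j a (λ { refl → <⇒≱ q<p p≤i }) (λ { refl → <⇒≱ q<p p≤j })) (fixed q q<p)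

  CanonicalBelow-suc : ∀ {p a P} → toℕ P ≡ p → CanonicalBelow p a → a P ≡ c P → CanonicalBelow (suc p) a
  CanonicalBelow-suc {a = a} refl fixed a[P]≡c[P] q q<1+p with m<1+n⇒m<n∨m≡n q<1+p
  ... | inj₁ q<p = fixed q q<p
  ... | inj₂ q≡P = subst (λ z → a z ≡ c z) (sym (toℕ-injective q≡P)) a[P]≡c[P]

  record Window (p lo hi : ℕ) : Set where
    field
      outside : ∀ q → toℕ q < p → c q ≤ lo ⊎ hi < c q
      covered : ∀ v → 1 ≤ v → v ≤ n → v ≤ lo ⊎ hi < v → ∃ λ q → toℕ q < p × c q ≡ v

  window-empty : Window 0 0 n
  window-empty = record
    { outside = λ _ ()
    ; covered = λ { v 1≤v _ (inj₁ v≤0) → contradiction v≤0 (<⇒≱ 1≤v)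
                  ; v _ v≤n (inj₂ n<v) → contradiction v≤n (<⇒≱ n<v) } }

  private
    widen : ∀ {p v} → (∃ λ q → toℕ q < p × c q ≡ v) → ∃ λ q → toℕ q < suc p × c q ≡ v
    widen (q , q<p , c[q]≡v) = q , m<n⇒m<1+n q<p , c[q]≡v

  window-low : ∀ {p lo hi P} → toℕ P ≡ p → c P ≡ suc lo → Window p lo hi → Window (suc p) (suc lo) hi
  window-low {p} {lo} {hi} {P} refl c[P]≡1+lo W = record { outside = outside′ ; covered = covered′ }
    where
    open Window W
    outside′ : ∀ q → toℕ q < suc p → c q ≤ suc lo ⊎ hi < c q
    outside′ q q<1+p with m<1+n⇒m<n∨m≡n q<1+p
    ... | inj₁ q<p = map₁ m≤n⇒m≤1+n (outside q q<p)
    ... | inj₂ q≡P = inj₁ (≤-reflexive (trans (cong c (toℕ-injective q≡P)) c[P]≡1+lo))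
    covered′ : ∀ v → 1 ≤ v → v ≤ n → v ≤ suc lo ⊎ hi < v → ∃ λ q → toℕ q < suc p × c q ≡ v
    covered′ v 1≤v v≤n (inj₂ hi<v) = widen (covered v 1≤v v≤n (inj₂ hi<v))
    covered′ v 1≤v v≤n (inj₁ v≤1+lo) with m≤n⇒m<n∨m≡n v≤1+lo
    ... | inj₁ v<1+lo = widen (covered v 1≤v v≤n (inj₁ (s≤s⁻¹ v<1+lo)))
    ... | inj₂ refl   = P , ≤-refl , c[P]≡1+lo

  window-high : ∀ {p lo hi P} → toℕ P ≡ p → c P ≡ suc hi → Window p lo (suc hi) → Window (suc p) lo hi
  window-high {p} {lo} {hi} {P} refl c[P]≡1+hi W = record { outside = outside′ ; covered = covered′ }
    where
    open Window W
    outside′ : ∀ q → toℕ q < suc p → c q ≤ lo ⊎ hi < c q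
    outside′ q q<1+p with m<1+n⇒m<n∨m≡n q<1+p
    ... | inj₁ q<p = map₂ (<-trans (n<1+n hi)) (outside q q<p)
    ... | inj₂ q≡P = inj₂ (≤-reflexive (sym (trans (cong c (toℕ-injective q≡P)) c[P]≡1+hi)))
    covered′ : ∀ v → 1 ≤ v → v ≤ n → v ≤ lo ⊎ hi < v → ∃ λ q → toℕ q < suc p × c q ≡ v
    covered′ v 1≤v v≤n (inj₁ v≤lo) = widen (covered v 1≤v v≤n (inj₁ v≤lo))
    covered′ v 1≤v v≤n (inj₂ hi<v) with m≤n⇒m<n∨m≡n hi<v
    ... | inj₁ 1+hi<v = widen (covered v 1≤v v≤n (inj₂ 1+hi<v))
    ... | inj₂ refl   = P , ≤-refl , c[P]≡1+hi

  window-valley : ∀ k → k + k ≤ n → Window (k + k) k (n ∸ k)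
  window-peak   : ∀ k → suc (k + k) ≤ n → Window (suc (k + k)) (suc k) (n ∸ k)

  window-valley zero    _  = window-empty
  window-valley (suc k) le =
    subst (λ p → Window p (suc k) (n ∸ suc k)) (cong suc (sym (+-suc k k)))
      (window-high (toℕ-fromℕ< 2k+1<n) (trans (canonical-odd {k = k} (toℕ-fromℕ< 2k+1<n)) hi≡)
        (subst (Window _ _) hi≡ (window-peak k (<⇒≤ 2k+1<n))))
    where
    2k+1<n : suc (k + k) < n
    2k+1<n = subst (_≤ n) (cong suc (+-suc k k)) le
    hi≡ : n ∸ k ≡ suc (n ∸ suc k)
    hi≡ = m∸n≡1+[m∸1+n] (<⇒≤ (≤-<-trans (s≤s (m≤m+n k k)) 2k+1<n))

  window-peak k 2k<n =
    window-low (toℕ-fromℕ< 2k<n) (canonical-even (toℕ-fromℕ< 2k<n)) (window-valley k (<⇒≤ 2k<n))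

  module _ {p lo hi} (W : Window p lo hi) {a} (perm : IsPermutation a) (fixed : CanonicalBelow p a) where
    open Window W

    beyond⇒inWindow : ∀ r → p ≤ toℕ r → lo < a r × a r ≤ hi
    beyond⇒inWindow r p≤r = ≰⇒> (taken ∘ inj₁) , ≮⇒≥ (taken ∘ inj₂)
      where
      taken : ¬ (a r ≤ lo ⊎ hi < a r)
      taken out with covered (a r) (proj₁ (proj₁ perm r)) (proj₂ (proj₁ perm r)) out
      ... | q , q<p , c[q]≡a[r] =
        <⇒≱ q<p (subst (λ z → p ≤ toℕ z) (sym (proj₂ perm (trans (fixed q q<p) c[q]≡a[r]))) p≤r)

    inWindow⇒beyond : ∀ r → lo < a r → a r ≤ hi → p ≤ toℕ r
    inWindow⇒beyond r lo<a[r] a[r]≤hi = ≮⇒≥ λ r<p →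
      let a[r]≡c[r] = fixed r r<p in
      [ (λ c[r]≤lo → <⇒≱ lo<a[r] (subst (_≤ lo) (sym a[r]≡c[r]) c[r]≤lo))
      , (λ hi<c[r] → <⇒≱ (subst (hi <_) (sym a[r]≡c[r]) hi<c[r]) a[r]≤hi)
      ]′ (outside r r<p)

    partner : ∀ {P} → toℕ P ≡ p → ∀ {w} → lo < w → w ≤ hi → w ≤ n → w ≢ a P →
              (∀ r → toℕ r ≡ suc p → a r ≢ w) → ∃ λ r → a r ≡ w × 2 + p ≤ toℕ r
    partner {P} refl {w} lo<w w≤hi w≤n w≢a[P] not-next
      with r , a[r]≡w ← IsPermutation⇒surjective perm (≤-trans (s≤s z≤n) lo<w) w≤n
      with m≤n⇒m<n∨m≡n (inWindow⇒beyond r (subst (lo <_) (sym a[r]≡w) lo<w)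
                                           (subst (_≤ hi) (sym a[r]≡w) w≤hi))
    ... | inj₂ P≡r = contradiction (trans (cong a (toℕ-injective P≡r)) a[r]≡w) (w≢a[P] ∘ sym)
    ... | inj₁ P<r with m≤n⇒m<n∨m≡n P<r
    ...   | inj₁ 1+P<r = r , a[r]≡w , 1+P<r
    ...   | inj₂ 1+P≡r = contradiction a[r]≡w (not-next r (sym 1+P≡r))

  Completable : ℕ → Set
  Completable p = ∀ a → IsPermutation a → IsUpDown a → CanonicalBelow p a → UpDownPath a c

  completable-≥n : ∀ {p} → n ≤ p → Completable p
  completable-≥n n≤p a _ _ fixed = done λ q → fixed q (<-≤-trans (toℕ<n q) n≤p)

  completeValley : ∀ k → k + k < n → Completable (suc (k + k)) → Completable (k + k)
  completeValley k 2k<n next a perm ud fixed =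
    descend (a P ∸ suc k) a perm ud fixed (sym (m∸n+n≡m (proj₁ (P-inWindow perm fixed))))
    where
    P = fromℕ< 2k<n
    P≡2k : toℕ P ≡ k + k
    P≡2k = toℕ-fromℕ< 2k<n
    W = window-valley k (<⇒≤ 2k<n)
    P-inWindow : ∀ {a} → IsPermutation a → CanonicalBelow (k + k) a → k < a P × a P ≤ n ∸ k
    P-inWindow perm fixed = beyond⇒inWindow W perm fixed P (≤-reflexive (sym P≡2k))
    descend : ∀ d a → IsPermutation a → IsUpDown a → CanonicalBelow (k + k) a →
              a P ≡ d + suc k → UpDownPath a c
    descend zero    a perm ud fixed a[P]≡1+k =
      next a perm ud (CanonicalBelow-suc P≡2k fixed (trans a[P]≡1+k (sym (canonical-even {k = k} P≡2k))))
    descend (suc d) a perm ud fixed a[P]≡1+w =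
      swapWithPartner (partner W perm fixed P≡2k (m≤n+m (suc k) d) w≤hi (≤-trans w≤hi (m∸n≤m n k))
                         (<⇒≢ w<a[P])
                         (λ r r≡1+P a[r]≡w → <-asym (ascent r≡1+P) (subst (_< a P) (sym a[r]≡w) w<a[P])))
      where
      w<a[P] : d + suc k < a P
      w<a[P] = ≤-reflexive (sym a[P]≡1+w)
      w≤hi : d + suc k ≤ n ∸ k
      w≤hi = <⇒≤ (<-≤-trans w<a[P] (proj₂ (P-inWindow perm fixed)))
      ascent : ∀ {r} → toℕ r ≡ suc (k + k) → a P < a r
      ascent r≡1+P = IsUpDown⇒ascent ud (trans r≡1+P (cong suc (sym P≡2k)))
                                        (trans (cong parity P≡2k) (parity[n+n]≡even k))
      swapWithPartner : (∃ λ r → a r ≡ d + suc k × 2 + (k + k) ≤ toℕ r) → UpDownPath a c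
      swapWithPartner (r , a[r]≡w , 2+P≤r) =
        moveAdjacentValues perm ud (trans a[P]≡1+w (cong suc (sym a[r]≡w)))
          (subst (λ x → 1 < ∣ toℕ r - x ∣) (sym P≡2k) (2+m≤n⇒1<∣n-m∣ 2+P≤r))
          λ perm′ ud′ → descend d _ perm′ ud′
            (CanonicalBelow-swapAt (≤-trans (m≤n+m _ 2) 2+P≤r) (≤-reflexive (sym P≡2k)) fixed)
            (trans (swapAt-j r P a) a[r]≡w)

  completePeak : ∀ k → suc (k + k) < n → Completable (suc (suc (k + k))) → Completable (suc (k + k))
  completePeak k 2k+1<n next a perm ud fixed =
    ascend (n ∸ k ∸ a P) a perm ud fixed (m∸n+n≡m (proj₂ (P-inWindow perm fixed)))
    where
    P = fromℕ< 2k+1<n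
    P≡2k+1 : toℕ P ≡ suc (k + k)
    P≡2k+1 = toℕ-fromℕ< 2k+1<n
    W = window-peak k (<⇒≤ 2k+1<n)
    P-inWindow : ∀ {a} → IsPermutation a → CanonicalBelow (suc (k + k)) a → suc k < a P × a P ≤ n ∸ k
    P-inWindow perm fixed = beyond⇒inWindow W perm fixed P (≤-reflexive (sym P≡2k+1))
    ascend : ∀ d a → IsPermutation a → IsUpDown a → CanonicalBelow (suc (k + k)) a →
             d + a P ≡ n ∸ k → UpDownPath a c
    ascend zero    a perm ud fixed a[P]≡hi =
      next a perm ud (CanonicalBelow-suc P≡2k+1 fixed (trans a[P]≡hi (sym (canonical-odd {k = k} P≡2k+1))))
    ascend (suc d) a perm ud fixed 1+d+a[P]≡hi =
      swapWithPartner (partner W perm fixed P≡2k+1 lo<w w≤hi (≤-trans w≤hi (m∸n≤m n k))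
                         (<⇒≢ (n<1+n _) ∘ sym)
                         (λ r r≡1+P a[r]≡w → <-asym (descent r≡1+P) (subst (a P <_) (sym a[r]≡w) (n<1+n _))))
      where
      lo<w : suc k < suc (a P)
      lo<w = m<n⇒m<1+n (proj₁ (P-inWindow perm fixed))
      w≤hi : suc (a P) ≤ n ∸ k
      w≤hi = subst (suc (a P) ≤_) 1+d+a[P]≡hi (s≤s (m≤n+m (a P) d))
      descent : ∀ {r} → toℕ r ≡ suc (suc (k + k)) → a r < a P
      descent r≡1+P = IsUpDown⇒descent ud (trans r≡1+P (cong suc (sym P≡2k+1)))
                                          (trans (cong parity P≡2k+1) (parity[1+n+n]≡odd k))
      swapWithPartner : (∃ λ r → a r ≡ suc (a P) × 2 + suc (k + k) ≤ toℕ r) → UpDownPath a c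
      swapWithPartner (r , a[r]≡w , 2+P≤r) =
        moveAdjacentValues perm ud a[r]≡w
          (subst (λ x → 1 < ∣ x - toℕ r ∣) (sym P≡2k+1)
            (subst (1 <_) (∣-∣-comm (toℕ r) _) (2+m≤n⇒1<∣n-m∣ 2+P≤r)))
          λ perm′ ud′ → ascend d _ perm′ ud′
            (CanonicalBelow-swapAt (≤-reflexive (sym P≡2k+1)) (≤-trans (m≤n+m _ 2) 2+P≤r) fixed)
            (trans (cong (d +_) (trans (swapAt-i P r a) a[r]≡w)) (trans (+-suc d (a P)) 1+d+a[P]≡hi))

  completable : ∀ m p → m + p ≡ n → Completable p
  completable zero    p refl = completable-≥n ≤-refl
  completable (suc m) p 1+m+p≡n with halve p | subst (p <_) 1+m+p≡n (s≤s (m≤n+m p m))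
  ... | k , inj₁ refl | p<n = completeValley k p<n (completable m _ (trans (+-suc m _) 1+m+p≡n))
  ... | k , inj₂ refl | p<n = completePeak   k p<n (completable m _ (trans (+-suc m _) 1+m+p≡n))

lemma3p4 : (n : ℕ) → 1 ≤ n → (a : PassiveForm n) → IsPermutation a → IsUpDown a →
    UpDownPath a (canonical n)
lemma3p4 n _ a perm ud = completable n 0 (+-identityʳ n) a perm ud (λ _ ())
  where open Completion n
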